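{- Let $\mathcal C_1,\mathcal C_2$ be chemical reaction networks (each a CRD or CRC) that each reverse-robustly compute (respectively decide) their predicate or function of inputs with input species $\{X_1,\dots,X_k\}$. Rename $X_i$ to $X_{i,1}$ in $\mathcal C_1$ and to $X_{i,2}$ in $\mathcal C_2$. Let $\mathcal C$ be the CRN whose species are those of $\mathcal C_1$ and $\mathcal C_2$ together with new species $X_1,\dots,X_k$, whose reactions are all reactions of $\mathcal C_1$ and of $\mathcal C_2$ together with, for each $i\in\{1,\dots,k\}$, the reaction $X_i\to X_{i,1}+X_{i,2}$, whose input species are $X_1,\dots,X_k$, and whose initial context is the sum of the initial contexts of $\mathcal C_1$ and $\mathcal C_2$. Then for every valid initial configuration $\vec i$ of $\mathcal C$ (with input $\vec x\in\mathbb{N}^k$) and every configuration $\vec c$ with $\vec i\looparrowright\vec c$, there exists a configuration $\vec o$ with $\vec c\to\vec o$ that is stable with respect to the outputs of both $\mathcal C_1$ and $\mathcal C_2$, and in which the output of $\mathcal C_1$ and the output of $\mathcal C_2$ are each correct for input $\vec x$.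
   Context: A CRN is a pair $(\Lambda,R)$ of a finite species set and a finite set of reactions $r=(\vec a,\vec p)\in\mathbb{N}^\Lambda\times\mathbb{N}^\Lambda$; the reverse of $r$ is $(\vec p,\vec a)$. Reaction $r$ is applicable to configuration $\vec x\in\mathbb{N}^\Lambda$ if $\vec x\geqq\vec a$, yielding $\vec x-\vec a+\vec p$. $\vec x\to\vec y$ means $\vec y$ is obtained by finitely many applications of forward reactions; $\vec x\looparrowright\vec y$ means it is obtained by finitely many applications of reactions and/or their reverses. A CRD $(\Lambda,R,\Sigma,\Upsilon_1,\Upsilon_0,\vec s)$ has input species $\Sigma$, yes/no voters $\Upsilon_1,\Upsilon_0$, and initial context $\vec s\in\mathbb{N}^{\Lambda\setminus\Sigma}$; its output $\Phi(\vec c)$ is $1$ (resp. $0$) if some yes (resp. no) voter is present and no no (resp. yes) voter is present, undefined otherwise; $\vec o$ is stable if $\Phi$ is constant on configurations reachable from $\vec o$. A CRC $(\Lambda,R,\Sigma,Y,\vec s)$ has output species $Y$; $\vec o$ is stable if the count of $Y$ is constant on configurations reachable from $\vec o$, and its output is $\vec o(Y)$. A valid initial configuration is the initial context plus any counts of input species. The CRN reverse-robustly computes its predicate/function $g$ if for every valid initial configuration $\vec i$ and every $\vec c$ with $\vec i\looparrowright\vec c$, there is a stable $\vec o$ with $\vec c\to\vec o$ whose output equals $g(\vec i|\Sigma)$. -}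

module Defs where

open import Data.Nat using (ℕ; _≤_; _<_; _∸_; _+_)
open import Data.Bool using (Bool; true; false; if_then_else_)
open import Data.Fin using (Fin; _≟_)
open import Data.Sum using (_⊎_; inj₁; inj₂; [_,_])
open import Data.Product using (Σ; ∃; _×_; _,_)
open import Data.List using (List; map; _++_; allFin)
open import Data.List.Relation.Unary.Any using (Any)
open import Relation.Nullary using (does)
open import Relation.Binary.PropositionalEquality using (_≡_)
open import Relation.Binary.Construct.Closure.ReflexiveTransitive using (Star)

Config : Set → Set
Config Λ = Λ → ℕ

record Reaction (Λ : Set) : Set where
  constructor _⟶_
  field
    reactants : Config Λ
    products  : Config Λ
open Reaction public

reverse : ∀ {Λ} → Reaction Λ → Reaction Λ
reverse (a ⟶ p) = p ⟶ a

Apply : ∀ {Λ} → Reaction Λ → Config Λ → Config Λ → Set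
Apply r x y = (∀ s → reactants r s ≤ x s) × (∀ s → y s ≡ (x s ∸ reactants r s) + products r s)

Step : ∀ {Λ} → List (Reaction Λ) → Config Λ → Config Λ → Set
Step R x y = Any (λ r → Apply r x y) R

StepRev : ∀ {Λ} → List (Reaction Λ) → Config Λ → Config Λ → Set
StepRev R x y = Any (λ r → Apply r x y ⊎ Apply (reverse r) x y) R

Reach : ∀ {Λ} → List (Reaction Λ) → Config Λ → Config Λ → Set
Reach R = Star (Step R)

ReachRev : ∀ {Λ} → List (Reaction Λ) → Config Λ → Config Λ → Set
ReachRev R = Star (StepRev R)

data Kind : Set where
  decider  : Kind
  computer : Kind

Val : Kind → Set
Val decider  = Bool
Val computer = ℕ

-- CRD: (yes voters Υ₁ , no voters Υ₀) as predicates; CRC: output species Y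
OutSpec : Set → Kind → Set
OutSpec Λ decider  = (Λ → Bool) × (Λ → Bool)
OutSpec Λ computer = Λ

Present : ∀ {Λ} → (Λ → Bool) → Config Λ → Set
Present V c = ∃ λ s → V s ≡ true × 0 < c s

Absent : ∀ {Λ} → (Λ → Bool) → Config Λ → Set
Absent V c = ∀ s → V s ≡ true → c s ≡ 0

OutIs : ∀ {Λ} κ → OutSpec Λ κ → Config Λ → Val κ → Set
OutIs decider  (Y₁ , Y₀) c true  = Present Y₁ c × Absent Y₀ c
OutIs decider  (Y₁ , Y₀) c false = Present Y₀ c × Absent Y₁ c
OutIs computer Y         c n     = c Y ≡ n

Stable : ∀ {Λ Λ'} κ → List (Reaction Λ') → (Config Λ' → Config Λ) →
         OutSpec Λ κ → Config Λ' → Set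
Stable κ R obs sp o = ∀ y → Reach R o y → ∀ v →
  (OutIs κ sp (obs o) v → OutIs κ sp (obs y) v) ×
  (OutIs κ sp (obs y) v → OutIs κ sp (obs o) v)

-- CRD / CRC with input species X₁..X_k (inj₁) and m further species (inj₂)

record CRNIO (κ : Kind) (k m : ℕ) : Set where
  field
    reactions : List (Reaction (Fin k ⊎ Fin m))
    context   : Fin m → ℕ
    output    : OutSpec (Fin k ⊎ Fin m) κ
open CRNIO public

initial : ∀ {κ k m} → CRNIO κ k m → (Fin k → ℕ) → Config (Fin k ⊎ Fin m)
initial C x = [ x , context C ]

ReverseRobustlyComputes : ∀ {κ k m} → CRNIO κ k m → ((Fin k → ℕ) → Val κ) → Set
ReverseRobustlyComputes {κ} C g = ∀ x c → ReachRev (reactions C) (initial C x) c →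
  ∃ λ o → Reach (reactions C) c o × Stable κ (reactions C) (λ z → z) (output C) o
        × OutIs κ (output C) o (g x)

-- Species: new X_i (inj₁ i), species of C₁ (inj₂ (inj₁ _)), species of C₂
-- (inj₂ (inj₂ _)); X_{i,1} = inj₂ (inj₁ (inj₁ i)), X_{i,2} = inj₂ (inj₂ (inj₁ i)).

Sp : ℕ → ℕ → ℕ → Set
Sp k m₁ m₂ = Fin k ⊎ ((Fin k ⊎ Fin m₁) ⊎ (Fin k ⊎ Fin m₂))

emb₁ : ∀ {k m₁ m₂} → Fin k ⊎ Fin m₁ → Sp k m₁ m₂
emb₁ s = inj₂ (inj₁ s)

emb₂ : ∀ {k m₁ m₂} → Fin k ⊎ Fin m₂ → Sp k m₁ m₂
emb₂ s = inj₂ (inj₂ s)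

obs₁ : ∀ {k m₁ m₂} → Config (Sp k m₁ m₂) → Config (Fin k ⊎ Fin m₁)
obs₁ c s = c (emb₁ s)

obs₂ : ∀ {k m₁ m₂} → Config (Sp k m₁ m₂) → Config (Fin k ⊎ Fin m₂)
obs₂ c s = c (emb₂ s)

lift₁ : ∀ {k m₁ m₂} → Config (Fin k ⊎ Fin m₁) → Config (Sp k m₁ m₂)
lift₁ v (inj₁ _)        = 0
lift₁ v (inj₂ (inj₁ s)) = v s
lift₁ v (inj₂ (inj₂ _)) = 0

lift₂ : ∀ {k m₁ m₂} → Config (Fin k ⊎ Fin m₂) → Config (Sp k m₁ m₂)
lift₂ v (inj₁ _)        = 0
lift₂ v (inj₂ (inj₁ _)) = 0
lift₂ v (inj₂ (inj₂ s)) = v s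

liftR₁ : ∀ {k m₁ m₂} → Reaction (Fin k ⊎ Fin m₁) → Reaction (Sp k m₁ m₂)
liftR₁ (a ⟶ p) = lift₁ a ⟶ lift₁ p

liftR₂ : ∀ {k m₁ m₂} → Reaction (Fin k ⊎ Fin m₂) → Reaction (Sp k m₁ m₂)
liftR₂ (a ⟶ p) = lift₂ a ⟶ lift₂ p

δ : ∀ {k} → Fin k → Fin k → ℕ
δ i j = if does (i ≟ j) then 1 else 0

split : ∀ {k m₁ m₂} → Fin k → Reaction (Sp k m₁ m₂)
split {k} {m₁} {m₂} i = a ⟶ p
  where
  a : Config (Sp k m₁ m₂)
  a (inj₁ j) = δ i j
  a (inj₂ _) = 0
  p : Config (Sp k m₁ m₂)
  p (inj₁ _)               = 0
  p (inj₂ (inj₁ (inj₁ j))) = δ i j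
  p (inj₂ (inj₁ (inj₂ _))) = 0
  p (inj₂ (inj₂ (inj₁ j))) = δ i j
  p (inj₂ (inj₂ (inj₂ _))) = 0

composeReactions : ∀ {κ₁ κ₂ k m₁ m₂} → CRNIO κ₁ k m₁ → CRNIO κ₂ k m₂ →
                   List (Reaction (Sp k m₁ m₂))
composeReactions C₁ C₂ =
  map liftR₁ (reactions C₁) ++ map liftR₂ (reactions C₂) ++ map split (allFin _)

composeContext : ∀ {κ₁ κ₂ k m₁ m₂} → CRNIO κ₁ k m₁ → CRNIO κ₂ k m₂ →
                 Config ((Fin k ⊎ Fin m₁) ⊎ (Fin k ⊎ Fin m₂))
composeContext C₁ C₂ s =
  lift₁ [ (λ _ → 0) , context C₁ ] (inj₂ s) + lift₂ [ (λ _ → 0) , context C₂ ] (inj₂ s)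

composeInitial : ∀ {κ₁ κ₂ k m₁ m₂} → CRNIO κ₁ k m₁ → CRNIO κ₂ k m₂ →
                 (Fin k → ℕ) → Config (Sp k m₁ m₂)
composeInitial C₁ C₂ x = [ x , composeContext C₁ C₂ ]

{-# OPTIONS --safe #-}
module Submission where

-- Count every X_i still present as an X_{i,1}.  Under this count each reaction of C,
-- forward or reversed, acts on the species of C₁ as a reaction of C₁ (or its reverse)
-- or not at all, so the C₁-part of anything reachable in C is reachable in C₁ from the
-- same input.  After firing all splits no X_i is left and none is ever produced again,
-- so C can run C₁ to a stable correct configuration, and every later path of C acts on
-- the C₁-part as a path of C₁, which keeps that output stable while C₂ does the same.

open import Defs
open import Data.Nat using (ℕ; zero; suc; _+_; _∸_; _≤_; _<_; z≤n; z<s)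
open import Data.Nat.Properties
  using ( +-identityʳ; +-∸-assoc; +-∸-comm; ∸-+-assoc; m∸n+n≡m; 0∸n≡0; +-mono-≤
        ; +-commutativeSemigroup)
open import Algebra.Properties.CommutativeSemigroup +-commutativeSemigroup using (interchange)
open import Data.Fin using (Fin; _≟_)
open import Data.Bool using (true; false; if_then_else_)
open import Data.Sum as Sum using (_⊎_; inj₁; inj₂)
open import Data.Product using (∃; _×_; _,_; proj₁; proj₂)
open import Data.List using (List; []; _∷_; map; allFin)
open import Data.Nat.ListAction using (sum)
open import Data.List.Relation.Unary.Any as Any using (here; there)
open import Data.List.Membership.Propositional using (_∈_; find; lose)
open import Data.List.Membership.Propositional.Properties
  using (∈-map⁺; ∈-map⁻; ∈-++⁺ˡ; ∈-++⁺ʳ; ∈-++⁻; ∈-allFin)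
open import Relation.Nullary using (yes; no)
open import Relation.Nullary.Decidable using (dec-true)
open import Relation.Binary.PropositionalEquality
  using (_≡_; _≗_; refl; sym; trans; cong; cong₂; subst; module ≡-Reasoning)
open import Relation.Binary.Construct.Closure.ReflexiveTransitive using (Star; ε; _◅_; _◅◅_; gmap)

private variable
  A Λ Λ' : Set
  κ : Kind
  R : List (Reaction Λ)
  R' : List (Reaction Λ')
  r r' : Reaction Λ
  x x' y o o' : Config Λ

_≈ᴿ_ : Reaction Λ → Reaction Λ → Set
r ≈ᴿ r' = reactants r ≗ reactants r' × products r ≗ products r'

Inert : Reaction Λ → Set
Inert r = reactants r ≗ products r

fire : Reaction Λ → Config Λ → Config Λ
fire r x s = x s ∸ reactants r s + products r s

Apply-respˡ : x' ≗ x → Apply r x y → Apply r x' y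
Apply-respˡ {r = r} ex (le , eq) =
  (λ s → subst (reactants r s ≤_) (sym (ex s)) (le s)) ,
  (λ s → trans (eq s) (cong (λ n → n ∸ reactants r s + products r s) (sym (ex s))))

Apply-resp-≈ᴿ : r ≈ᴿ r' → Apply r x y → Apply r' x y
Apply-resp-≈ᴿ {x = x} (ea , ep) (le , eq) =
  (λ s → subst (_≤ x s) (ea s) (le s)) ,
  (λ s → trans (eq s) (cong₂ _+_ (cong₂ _∸_ refl (ea s)) (ep s)))

Apply-inert : Inert r → Apply r x y → y ≗ x
Apply-inert {r = r} {x = x} inert (le , eq) s = begin
  _                                      ≡⟨ eq s ⟩
  x s ∸ reactants r s + products r s     ≡⟨ cong (x s ∸ reactants r s +_) (sym (inert s)) ⟩
  x s ∸ reactants r s + reactants r s    ≡⟨ m∸n+n≡m (le s) ⟩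
  x s                                    ∎
  where open ≡-Reasoning

Step-respˡ : x' ≗ x → Step R x y → Step R x' y
Step-respˡ ex = Any.map (Apply-respˡ ex)

StepRev-respˡ : x' ≗ x → StepRev R x y → StepRev R x' y
StepRev-respˡ ex = Any.map (Sum.map (Apply-respˡ ex) (Apply-respˡ ex))

Reach⇒ReachRev : Reach R x y → ReachRev R x y
Reach⇒ReachRev = gmap (λ z → z) (Any.map inj₁)

Star-simulate : {S : A → A → Set} {T : Config Λ → Config Λ → Set} (f : A → Config Λ) →
  (∀ {u u' v} → u' ≗ u → T u v → T u' v) →
  (∀ {a b} → S a b → T (f a) (f b) ⊎ f b ≗ f a) →
  ∀ {a b u} → Star S a b → u ≗ f a → ∃ λ v → Star T u v × v ≗ f b
Star-simulate f resp step ε e = _ , ε , e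
Star-simulate f resp step (s ◅ p) e with step s
... | inj₁ t = let v , q , e' = Star-simulate f resp step p (λ _ → refl) in v , resp e t ◅ q , e'
... | inj₂ e' = Star-simulate f resp step p (λ s → trans (e s) (sym (e' s)))

Reach-respˡ : x' ≗ x → Reach R x y → ∃ λ y' → Reach R x' y' × y' ≗ y
Reach-respˡ ex p = Star-simulate (λ z → z) Step-respˡ inj₁ p ex

Present-resp : {V : Λ → _} → Present V x → x ≗ y → Present V y
Present-resp (s , vs , pos) e = s , vs , subst (0 <_) (e s) pos

Absent-resp : {V : Λ → _} → Absent V x → x ≗ y → Absent V y
Absent-resp ab e s vs = trans (sym (e s)) (ab s vs)

OutIs-resp : ∀ {sp : OutSpec Λ κ} {v} → OutIs κ sp x v → x ≗ y → OutIs κ sp y v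
OutIs-resp {κ = decider} {v = true}  (p , a) e = Present-resp p e , Absent-resp a e
OutIs-resp {κ = decider} {v = false} (p , a) e = Present-resp p e , Absent-resp a e
OutIs-resp {κ = computer} {sp = Y} out e = trans (sym (e Y)) out

Settles : ∀ κ → List (Reaction Λ') → (Config Λ' → Config Λ) → OutSpec Λ κ → Val κ → Config Λ' → Set
Settles κ R obs sp v c = ∃ λ o → Reach R c o × Stable κ R obs sp o × OutIs κ sp (obs o) v

Settles-prepend : ∀ {obs : Config Λ' → Config Λ} {sp : OutSpec Λ κ} {v} →
  Reach R x x' → Settles κ R obs sp v x' → Settles κ R obs sp v x
Settles-prepend p (o , q , st , out) = o , p ◅◅ q , st , out

Stable-forward : ∀ {obs : Config Λ' → Config Λ} {sp : OutSpec Λ κ} →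
  Reach R o o' → Stable κ R obs sp o → Stable κ R obs sp o'
Stable-forward p st y q v =
  let to , from = st _ p v ; to' , from' = st y (p ◅◅ q) v
  in (λ h → to' (from h)) , (λ h → to (from' h))

Stable-transfer : ∀ {obs : Config Λ' → Config Λ} {sp : OutSpec Λ κ} {o : Config Λ'} →
  (∀ {y} → Reach R o y → ∃ λ y' → Reach R' o' y' × y' ≗ obs y) →
  obs o ≗ o' → Stable κ R' (λ z → z) sp o' → Stable κ R obs sp o
Stable-transfer {sp = sp} sim e st y p v =
  let y' , q , e' = sim p ; to , from = st y' q v
  in (λ h → OutIs-resp {sp = sp} (to (OutIs-resp {sp = sp} h e)) e') ,
     (λ h → OutIs-resp {sp = sp} (from (OutIs-resp {sp = sp} h (λ s → sym (e' s))))
                                 (λ s → sym (e s)))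

collapse : (Λ' → List Λ) → Config Λ → Config Λ'
collapse fiber x t = sum (map x (fiber t))

collapseR : (Λ' → List Λ) → Reaction Λ → Reaction Λ'
collapseR fiber r = collapse fiber (reactants r) ⟶ collapse fiber (products r)

∸-+-additive : ∀ {x a X A} p P → a ≤ x → A ≤ X →
  (x ∸ a + p) + (X ∸ A + P) ≡ (x + X) ∸ (a + A) + (p + P)
∸-+-additive {x} {a} {X} {A} p P a≤x A≤X = begin
  (x ∸ a + p) + (X ∸ A + P)      ≡⟨ interchange (x ∸ a) p (X ∸ A) P ⟩
  (x ∸ a + (X ∸ A)) + (p + P)    ≡⟨ cong (_+ (p + P)) (sym (+-∸-assoc (x ∸ a) A≤X)) ⟩
  (x ∸ a + X) ∸ A + (p + P)      ≡⟨ cong (λ n → n ∸ A + (p + P)) (sym (+-∸-comm X a≤x)) ⟩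
  (x + X) ∸ a ∸ A + (p + P)      ≡⟨ cong (_+ (p + P)) (∸-+-assoc (x + X) a A) ⟩
  (x + X) ∸ (a + A) + (p + P)    ∎
  where open ≡-Reasoning

Apply-collapse : (fiber : Λ' → List Λ) → Apply r x y →
  Apply (collapseR fiber r) (collapse fiber x) (collapse fiber y)
Apply-collapse {r = r} {x = x} {y = y} fiber (le , eq) =
  (λ t → proj₁ (sum-Apply (fiber t))) , (λ t → proj₂ (sum-Apply (fiber t)))
  where
  sum-Apply : ∀ ss → sum (map (reactants r) ss) ≤ sum (map x ss)
    × sum (map y ss) ≡ sum (map x ss) ∸ sum (map (reactants r) ss) + sum (map (products r) ss)
  sum-Apply [] = z≤n , refl
  sum-Apply (s ∷ ss) =
    let le' , eq' = sum-Apply ss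
    in +-mono-≤ (le s) le' , trans (cong₂ _+_ (eq s) eq') (∸-+-additive _ _ (le s) le')

Projects : (Λ' → List Λ) → List (Reaction Λ) → List (Reaction Λ') → Set
Projects fiber R R' = ∀ {r} → r ∈ R →
  (∃ λ r' → r' ∈ R' × collapseR fiber r ≈ᴿ r') ⊎ Inert (collapseR fiber r)

module _ (fiber : Λ' → List Λ) (proj : Projects fiber R R') where

  Step-project : Step R x y →
    Step R' (collapse fiber x) (collapse fiber y) ⊎ collapse fiber y ≗ collapse fiber x
  Step-project st with find st
  ... | r , r∈R , ap with proj r∈R
  ...   | inj₁ (r' , r'∈R' , r≈r') = inj₁ (lose r'∈R' (Apply-resp-≈ᴿ r≈r' (Apply-collapse fiber ap)))
  ...   | inj₂ inert = inj₂ (Apply-inert inert (Apply-collapse fiber ap))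

  StepRev-project : StepRev R x y →
    StepRev R' (collapse fiber x) (collapse fiber y) ⊎ collapse fiber y ≗ collapse fiber x
  StepRev-project st with find st
  ... | r , r∈R , ap with proj r∈R | ap
  ...   | inj₁ (r' , r'∈R' , ea , ep) | inj₁ fwd =
    inj₁ (lose r'∈R' (inj₁ (Apply-resp-≈ᴿ (ea , ep) (Apply-collapse fiber fwd))))
  ...   | inj₁ (r' , r'∈R' , ea , ep) | inj₂ bwd =
    inj₁ (lose r'∈R' (inj₂ (Apply-resp-≈ᴿ (ep , ea) (Apply-collapse fiber bwd))))
  ...   | inj₂ inert | inj₁ fwd = inj₂ (Apply-inert inert (Apply-collapse fiber fwd))
  ...   | inj₂ inert | inj₂ bwd = inj₂ (Apply-inert (λ s → sym (inert s)) (Apply-collapse fiber bwd))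

  Reach-project : ∀ {u} → Reach R x y → u ≗ collapse fiber x →
    ∃ λ v → Reach R' u v × v ≗ collapse fiber y
  Reach-project = Star-simulate (collapse fiber) Step-respˡ Step-project

  ReachRev-project : ∀ {u} → ReachRev R x y → u ≗ collapse fiber x →
    ∃ λ v → ReachRev R' u v × v ≗ collapse fiber y
  ReachRev-project = Star-simulate (collapse fiber) StepRev-respˡ StepRev-project

  Stable-project : ∀ {obs : Config Λ → Config Λ'} {sp : OutSpec Λ' κ} →
    (∀ {y} → Reach R o y → collapse fiber y ≗ obs y) →
    obs o ≗ o' → Stable κ R' (λ z → z) sp o' → Stable κ R obs sp o
  Stable-project {o = o} {o' = o'} {obs = obs} collapse≗obs e = Stable-transfer simulate e
    where
    simulate : ∀ {y} → Reach R o y → ∃ λ y' → Reach R' o' y' × y' ≗ obs y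
    simulate p =
      let y' , q , e' = Reach-project p (λ s → sym (trans (collapse≗obs ε s) (e s)))
      in y' , q , λ s → trans (e' s) (collapse≗obs p s)

δ-diag : ∀ {k} (i : Fin k) → δ i i ≡ 1
δ-diag i = cong (if_then 1 else 0) (dec-true (i ≟ i) refl)

module Composition {κ₁ κ₂ : Kind} {k m₁ m₂ : ℕ} (C₁ : CRNIO κ₁ k m₁) (C₂ : CRNIO κ₂ k m₂) where

  private variable
    c d : Config (Sp k m₁ m₂)

  R∥ : List (Reaction (Sp k m₁ m₂))
  R∥ = composeReactions C₁ C₂

  ∈-composeReactions⁻ : r ∈ R∥ →
    (∃ λ r₁ → r₁ ∈ reactions C₁ × r ≡ liftR₁ r₁) ⊎
    (∃ λ r₂ → r₂ ∈ reactions C₂ × r ≡ liftR₂ r₂) ⊎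
    (∃ λ i → r ≡ split i)
  ∈-composeReactions⁻ r∈ with ∈-++⁻ (map liftR₁ (reactions C₁)) r∈
  ... | inj₁ r∈R₁ = inj₁ (∈-map⁻ liftR₁ r∈R₁)
  ... | inj₂ r∈ with ∈-++⁻ (map liftR₂ (reactions C₂)) r∈
  ...   | inj₁ r∈R₂ = inj₂ (inj₁ (∈-map⁻ liftR₂ r∈R₂))
  ...   | inj₂ r∈splits = let i , _ , eq = ∈-map⁻ split r∈splits in inj₂ (inj₂ (i , eq))

  liftR₁∈ : r ∈ reactions C₁ → liftR₁ r ∈ R∥
  liftR₁∈ r∈ = ∈-++⁺ˡ (∈-map⁺ liftR₁ r∈)

  liftR₂∈ : r ∈ reactions C₂ → liftR₂ r ∈ R∥
  liftR₂∈ r∈ = ∈-++⁺ʳ (map liftR₁ (reactions C₁)) (∈-++⁺ˡ (∈-map⁺ liftR₂ r∈))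

  split∈ : ∀ i → split i ∈ R∥
  split∈ i = ∈-++⁺ʳ (map liftR₁ (reactions C₁))
    (∈-++⁺ʳ (map liftR₂ (reactions C₂)) (∈-map⁺ split (∈-allFin i)))

  Flushed : Config (Sp k m₁ m₂) → Set
  Flushed c = ∀ i → c (inj₁ i) ≡ 0

  products-input : r ∈ R∥ → ∀ i → products r (inj₁ i) ≡ 0
  products-input r∈ i with ∈-composeReactions⁻ r∈
  ... | inj₁ (_ , _ , refl)        = refl
  ... | inj₂ (inj₁ (_ , _ , refl)) = refl
  ... | inj₂ (inj₂ (_ , refl))     = refl

  Step-input-zero : ∀ i → Step R∥ c d → c (inj₁ i) ≡ 0 → d (inj₁ i) ≡ 0
  Step-input-zero {c} {d} i st z with find st
  ... | r , r∈ , (_ , eq) = begin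
    d (inj₁ i)                           ≡⟨ eq (inj₁ i) ⟩
    c (inj₁ i) ∸ a + products r (inj₁ i) ≡⟨ cong₂ (λ n p → n ∸ a + p) z (products-input r∈ i) ⟩
    0 ∸ a + 0                            ≡⟨ +-identityʳ (0 ∸ a) ⟩
    0 ∸ a                                ≡⟨ 0∸n≡0 a ⟩
    0                                    ∎
    where
    open ≡-Reasoning
    a = reactants r (inj₁ i)

  Reach-input-zero : ∀ i → Reach R∥ c d → c (inj₁ i) ≡ 0 → d (inj₁ i) ≡ 0
  Reach-input-zero i ε z = z
  Reach-input-zero i (st ◅ p) z = Reach-input-zero i p (Step-input-zero i st z)

  Reach-Flushed : Reach R∥ c d → Flushed c → Flushed d
  Reach-Flushed p flat i = Reach-input-zero i p (flat i)

  split-applicable : ∀ {i} → 0 < c (inj₁ i) → ∀ s → reactants (split i) s ≤ c s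
  split-applicable {i = i} pos (inj₁ j) with i ≟ j
  ... | yes refl = pos
  ... | no _     = z≤n
  split-applicable pos (inj₂ _) = z≤n

  drain : ∀ i n c → c (inj₁ i) ≡ n → ∃ λ d → Reach R∥ c d × d (inj₁ i) ≡ 0
  drain i zero    c e = c , ε , e
  drain i (suc n) c e =
    let d , p , z = drain i n (fire (split i) c) (trans (+-identityʳ _) (cong₂ _∸_ e (δ-diag i)))
    in d , lose (split∈ i) (split-applicable (subst (0 <_) (sym e) z<s) , λ _ → refl) ◅ p , z

  flush-inputs : ∀ (is : List (Fin k)) c →
    ∃ λ d → Reach R∥ c d × (∀ {i} → i ∈ is → d (inj₁ i) ≡ 0)
  flush-inputs []       c = c , ε , λ ()
  flush-inputs (i ∷ is) c =
    let c' , p , flat = flush-inputs is c ; d , q , z = drain i _ c' refl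
    in d , p ◅◅ q , λ { (here refl) → z ; (there i∈) → Reach-input-zero _ q (flat i∈) }

  flush : ∀ c → ∃ λ d → Reach R∥ c d × Flushed d
  flush c = let d , p , flat = flush-inputs (allFin k) c in d , p , λ i → flat (∈-allFin i)

  -- each unsplit X_i is counted as the X_{i,1} it will become
  fiber₁ : Fin k ⊎ Fin m₁ → List (Sp k m₁ m₂)
  fiber₁ (inj₁ i) = inj₁ i ∷ emb₁ (inj₁ i) ∷ []
  fiber₁ (inj₂ s) = emb₁ (inj₂ s) ∷ []

  collapse-lift₁ : ∀ v → collapse fiber₁ (lift₁ v) ≗ v
  collapse-lift₁ v (inj₁ i) = +-identityʳ _
  collapse-lift₁ v (inj₂ s) = +-identityʳ _

  projects₁ : Projects fiber₁ R∥ (reactions C₁)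
  projects₁ r∈ with ∈-composeReactions⁻ r∈
  ... | inj₁ (r₁ , r₁∈ , refl) = 
    inj₁ (r₁ , r₁∈ , collapse-lift₁ (reactants r₁) , collapse-lift₁ (products r₁))
  ... | inj₂ (inj₁ (_ , _ , refl)) = inj₂ λ { (inj₁ _) → refl ; (inj₂ _) → refl }
  ... | inj₂ (inj₂ (_ , refl))     = inj₂ λ { (inj₁ _) → refl ; (inj₂ _) → refl }

  collapse-initial₁ : ∀ x → initial C₁ x ≗ collapse fiber₁ (composeInitial C₁ C₂ x)
  collapse-initial₁ x (inj₁ i) = sym (+-identityʳ _)
  collapse-initial₁ x (inj₂ s) = sym (trans (+-identityʳ _) (+-identityʳ _))

  collapse-flushed₁ : ∀ {c} → Flushed c → collapse fiber₁ c ≗ obs₁ c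
  collapse-flushed₁ {c} flat (inj₁ i) = trans (cong (_+ (c (emb₁ (inj₁ i)) + 0)) (flat i)) (+-identityʳ _)
  collapse-flushed₁ flat (inj₂ s) = +-identityʳ _

  replace₁ : Config (Sp k m₁ m₂) → Config (Fin k ⊎ Fin m₁) → Config (Sp k m₁ m₂)
  replace₁ c v (inj₁ i)        = c (inj₁ i)
  replace₁ c v (inj₂ (inj₁ s)) = v s
  replace₁ c v (inj₂ (inj₂ s)) = c (inj₂ (inj₂ s))

  Apply-replace₁ : ∀ {u v} → Apply r u v → Apply (liftR₁ r) (replace₁ c u) (replace₁ c v)
  Apply-replace₁ {r} {c} {u} {v} (le , eq) = le' , eq'
    where
    le' : ∀ s → lift₁ (reactants r) s ≤ replace₁ c u s
    le' (inj₁ _)        = z≤n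
    le' (inj₂ (inj₁ s)) = le s
    le' (inj₂ (inj₂ _)) = z≤n
    eq' : ∀ s → replace₁ c v s ≡ replace₁ c u s ∸ lift₁ (reactants r) s + lift₁ (products r) s
    eq' (inj₁ _)        = sym (+-identityʳ _)
    eq' (inj₂ (inj₁ s)) = eq s
    eq' (inj₂ (inj₂ _)) = sym (+-identityʳ _)

  Reach-replace₁ : ∀ {c u v} → Reach (reactions C₁) u v → Reach R∥ (replace₁ c u) (replace₁ c v)
  Reach-replace₁ {c} = gmap (replace₁ c) λ st →
    let r , r∈ , ap = find st in lose (liftR₁∈ r∈) (Apply-replace₁ ap)

  reachable₁ : ∀ {x c} → ReachRev R∥ (composeInitial C₁ C₂ x) c → Flushed c →
    ∃ λ v → ReachRev (reactions C₁) (initial C₁ x) v × v ≗ obs₁ c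
  reachable₁ {x} c↬ flat =
    let v , init↬v , e = ReachRev-project fiber₁ projects₁ c↬ (collapse-initial₁ x)
    in v , init↬v , λ s → trans (e s) (collapse-flushed₁ flat s)

  lift-settles₁ : ∀ {c v w} → Flushed c → v ≗ obs₁ c →
    Settles κ₁ (reactions C₁) (λ z → z) (output C₁) w v → Settles κ₁ R∥ obs₁ (output C₁) w c
  lift-settles₁ {c} {v} flat e (o₁ , v→o₁ , stable , out) =
    let o , c→o , o≈ = Reach-respˡ c≈ (Reach-replace₁ v→o₁)
        flat-o : Flushed o
        flat-o i = trans (o≈ (inj₁ i)) (flat i)
    in o , c→o ,
       Stable-project fiber₁ projects₁ (λ p → collapse-flushed₁ (Reach-Flushed p flat-o))
         (λ s → o≈ (emb₁ s)) stable ,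
       OutIs-resp {sp = output C₁} out (λ s → sym (o≈ (emb₁ s)))
    where
    c≈ : c ≗ replace₁ c v
    c≈ (inj₁ _)        = refl
    c≈ (inj₂ (inj₁ s)) = sym (e s)
    c≈ (inj₂ (inj₂ _)) = refl

  settles₁ : ∀ {g₁} → ReverseRobustlyComputes C₁ g₁ → ∀ {x c} →
    ReachRev R∥ (composeInitial C₁ C₂ x) c → Settles κ₁ R∥ obs₁ (output C₁) (g₁ x) c
  settles₁ rr₁ {x} {c} c↬ =
    let c' , c→c' , flat = flush c
        v , init↬v , e = reachable₁ (c↬ ◅◅ Reach⇒ReachRev c→c') flat
    in Settles-prepend c→c' (lift-settles₁ flat e (rr₁ x v init↬v))

  fiber₂ : Fin k ⊎ Fin m₂ → List (Sp k m₁ m₂)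
  fiber₂ (inj₁ i) = inj₁ i ∷ emb₂ (inj₁ i) ∷ []
  fiber₂ (inj₂ s) = emb₂ (inj₂ s) ∷ []

  collapse-lift₂ : ∀ v → collapse fiber₂ (lift₂ v) ≗ v
  collapse-lift₂ v (inj₁ i) = +-identityʳ _
  collapse-lift₂ v (inj₂ s) = +-identityʳ _

  projects₂ : Projects fiber₂ R∥ (reactions C₂)
  projects₂ r∈ with ∈-composeReactions⁻ r∈
  ... | inj₁ (_ , _ , refl)        = inj₂ λ { (inj₁ _) → refl ; (inj₂ _) → refl }
  ... | inj₂ (inj₁ (r₂ , r₂∈ , refl)) = 
    inj₁ (r₂ , r₂∈ , collapse-lift₂ (reactants r₂) , collapse-lift₂ (products r₂))
  ... | inj₂ (inj₂ (_ , refl))     = inj₂ λ { (inj₁ _) → refl ; (inj₂ _) → refl }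

  collapse-initial₂ : ∀ x → initial C₂ x ≗ collapse fiber₂ (composeInitial C₁ C₂ x)
  collapse-initial₂ x (inj₁ i) = sym (+-identityʳ _)
  collapse-initial₂ x (inj₂ s) = sym (+-identityʳ _)

  collapse-flushed₂ : ∀ {c} → Flushed c → collapse fiber₂ c ≗ obs₂ c
  collapse-flushed₂ {c} flat (inj₁ i) = trans (cong (_+ (c (emb₂ (inj₁ i)) + 0)) (flat i)) (+-identityʳ _)
  collapse-flushed₂ flat (inj₂ s) = +-identityʳ _

  replace₂ : Config (Sp k m₁ m₂) → Config (Fin k ⊎ Fin m₂) → Config (Sp k m₁ m₂)
  replace₂ c v (inj₁ i)        = c (inj₁ i)
  replace₂ c v (inj₂ (inj₁ s)) = c (inj₂ (inj₁ s))
  replace₂ c v (inj₂ (inj₂ s)) = v s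

  Apply-replace₂ : ∀ {u v} → Apply r u v → Apply (liftR₂ r) (replace₂ c u) (replace₂ c v)
  Apply-replace₂ {r} {c} {u} {v} (le , eq) = le' , eq'
    where
    le' : ∀ s → lift₂ (reactants r) s ≤ replace₂ c u s
    le' (inj₁ _)        = z≤n
    le' (inj₂ (inj₁ _)) = z≤n
    le' (inj₂ (inj₂ s)) = le s
    eq' : ∀ s → replace₂ c v s ≡ replace₂ c u s ∸ lift₂ (reactants r) s + lift₂ (products r) s
    eq' (inj₁ _)        = sym (+-identityʳ _)
    eq' (inj₂ (inj₁ _)) = sym (+-identityʳ _)
    eq' (inj₂ (inj₂ s)) = eq s

  Reach-replace₂ : ∀ {c u v} → Reach (reactions C₂) u v → Reach R∥ (replace₂ c u) (replace₂ c v)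
  Reach-replace₂ {c} = gmap (replace₂ c) λ st →
    let r , r∈ , ap = find st in lose (liftR₂∈ r∈) (Apply-replace₂ ap)

  reachable₂ : ∀ {x c} → ReachRev R∥ (composeInitial C₁ C₂ x) c → Flushed c →
    ∃ λ v → ReachRev (reactions C₂) (initial C₂ x) v × v ≗ obs₂ c
  reachable₂ {x} c↬ flat =
    let v , init↬v , e = ReachRev-project fiber₂ projects₂ c↬ (collapse-initial₂ x)
    in v , init↬v , λ s → trans (e s) (collapse-flushed₂ flat s)

  lift-settles₂ : ∀ {c v w} → Flushed c → v ≗ obs₂ c →
    Settles κ₂ (reactions C₂) (λ z → z) (output C₂) w v → Settles κ₂ R∥ obs₂ (output C₂) w c
  lift-settles₂ {c} {v} flat e (o₂ , v→o₂ , stable , out) =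
    let o , c→o , o≈ = Reach-respˡ c≈ (Reach-replace₂ v→o₂)
        flat-o : Flushed o
        flat-o i = trans (o≈ (inj₁ i)) (flat i)
    in o , c→o ,
       Stable-project fiber₂ projects₂ (λ p → collapse-flushed₂ (Reach-Flushed p flat-o))
         (λ s → o≈ (emb₂ s)) stable ,
       OutIs-resp {sp = output C₂} out (λ s → sym (o≈ (emb₂ s)))
    where
    c≈ : c ≗ replace₂ c v
    c≈ (inj₁ _)        = refl
    c≈ (inj₂ (inj₁ _)) = refl
    c≈ (inj₂ (inj₂ s)) = sym (e s)

  settles₂ : ∀ {g₂} → ReverseRobustlyComputes C₂ g₂ → ∀ {x c} →
    ReachRev R∥ (composeInitial C₁ C₂ x) c → Settles κ₂ R∥ obs₂ (output C₂) (g₂ x) c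
  settles₂ rr₂ {x} {c} c↬ =
    let c' , c→c' , flat = flush c
        v , init↬v , e = reachable₂ (c↬ ◅◅ Reach⇒ReachRev c→c') flat
    in Settles-prepend c→c' (lift-settles₂ flat e (rr₂ x v init↬v))

lemma4 : ∀ {κ₁ κ₂ : Kind} {k m₁ m₂ : ℕ}
         (C₁ : CRNIO κ₁ k m₁) (C₂ : CRNIO κ₂ k m₂)
         (g₁ : (Fin k → ℕ) → Val κ₁) (g₂ : (Fin k → ℕ) → Val κ₂) →
         ReverseRobustlyComputes C₁ g₁ →
         ReverseRobustlyComputes C₂ g₂ →
         ∀ (x : Fin k → ℕ) (c : Config (Sp k m₁ m₂)) →
         ReachRev (composeReactions C₁ C₂) (composeInitial C₁ C₂ x) c →
         ∃ λ o → Reach (composeReactions C₁ C₂) c o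
           × Stable κ₁ (composeReactions C₁ C₂) obs₁ (output C₁) o
           × Stable κ₂ (composeReactions C₁ C₂) obs₂ (output C₂) o
           × OutIs κ₁ (output C₁) (obs₁ o) (g₁ x)
           × OutIs κ₂ (output C₂) (obs₂ o) (g₂ x)
lemma4 C₁ C₂ g₁ g₂ rr₁ rr₂ x c c↬ =
  let o' , c→o' , stable₁ , out₁ = settles₁ rr₁ c↬
      o , o'→o , stable₂ , out₂ = settles₂ rr₂ (c↬ ◅◅ Reach⇒ReachRev c→o')
  in o , c→o' ◅◅ o'→o , Stable-forward o'→o stable₁ , stable₂ ,
     proj₁ (stable₁ o o'→o (g₁ x)) out₁ , out₂
  where open Composition C₁ C₂
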